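{- Let $G$ be a connected bipartite graph of order $n\ge 2$. Then $\chi_i'(G)\le n-\frac{n-1}{\Delta(G)}$, $\chi_i'(G)\le n-i(G)$, and $\chi_i'(G)\le \alpha(G)$.
   Context: All graphs are finite and simple. $\Delta(G)$ is the maximum degree, $\alpha(G)$ the independence number, and $i(G)$ the independent domination number of $G$ (the minimum cardinality of a maximal independent set). Three edges $e_1,e_2,e_3$ (in this order) are consecutive if $e_1=xy$, $e_2=yz$, $e_3=zu$ for some vertices $x,y,z,u$ (where $x=u$ is allowed). An injective edge coloring of $G$ is a map $c:E(G)\to\mathcal{C}$ such that whenever $e_1,e_2,e_3$ are consecutive edges, $c(e_1)\neq c(e_3)$. $\chi_i'(G)$ is the minimum number of colors in an injective edge coloring of $G$. -}

module Defs where

import Data.Nat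
open import Data.Nat using (ℕ; zero; suc; _+_; _⊔_; _<_)
open import Data.Bool using (Bool; true; false; T; if_then_else_)
open import Data.Fin using (Fin)
open import Data.Fin.Subset using (Subset; _∈_; _∉_; ∣_∣; ⁅_⁆; _∪_)
open import Data.List using (List; []; _∷_; map; foldr; allFin)
open import Data.Nat.ListAction using (sum)
open import Data.Product using (Σ; ∃; _×_; _,_)
open import Relation.Nullary using (¬_)
open import Relation.Binary.PropositionalEquality using (_≡_; _≢_)

record Graph (n : ℕ) : Set where
  field
    adj     : Fin n → Fin n → Bool
    sym     : ∀ u v → adj u v ≡ adj v u
    irrefl  : ∀ v → adj v v ≡ false

open Graph public

E : ∀ {n} → Graph n → Fin n → Fin n → Set
E G u v = T (adj G u v)

degree : ∀ {n} → Graph n → Fin n → ℕ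
degree {n} G u = sum (map (λ v → if adj G u v then 1 else 0) (allFin n))

Δ : ∀ {n} → Graph n → ℕ
Δ {n} G = foldr _⊔_ 0 (map (degree G) (allFin n))

data Walk {n} (G : Graph n) : Fin n → Fin n → Set where
  here : ∀ {u} → Walk G u u
  step : ∀ {u v w} → E G u v → Walk G v w → Walk G u w

Connected : ∀ {n} → Graph n → Set
Connected {n} G = ∀ (u v : Fin n) → Walk G u v

Bipartite : ∀ {n} → Graph n → Set
Bipartite {n} G = Σ (Fin n → Bool) λ f → ∀ u v → E G u v → f u ≢ f v

Independent : ∀ {n} → Graph n → Subset n → Set
Independent G S = ∀ u v → u ∈ S → v ∈ S → ¬ E G u v

MaximalIndependent : ∀ {n} → Graph n → Subset n → Set
MaximalIndependent G S =
  Independent G S × (∀ v → v ∉ S → ¬ Independent G (⁅ v ⁆ ∪ S))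

IsIndependenceNumber : ∀ {n} → Graph n → ℕ → Set
IsIndependenceNumber G a =
  (Σ (Subset _) λ S → Independent G S × ∣ S ∣ ≡ a)
  × (∀ S → Independent G S → ∣ S ∣ Data.Nat.≤ a)

IsIndependentDominationNumber : ∀ {n} → Graph n → ℕ → Set
IsIndependentDominationNumber G m =
  (Σ (Subset _) λ S → MaximalIndependent G S × ∣ S ∣ ≡ m)
  × (∀ S → MaximalIndependent G S → m Data.Nat.≤ ∣ S ∣)

-- An edge colouring with colour set Fin k: a colour for every edge uv,
-- represented as a function on ordered adjacent pairs that is symmetric
-- (values on non-adjacent pairs are irrelevant).
-- Injective: for consecutive edges xy, yz, zu (distinct consecutive edges,
-- i.e. x ≠ z and y ≠ u; x = u allowed) the colours of xy and zu differ.
InjectiveEdgeColoring : ∀ {n} → Graph n → (k : ℕ) → (Fin n → Fin n → Fin k) → Set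
InjectiveEdgeColoring {n} G k c =
  (∀ u v → E G u v → c u v ≡ c v u)
  × (∀ (x y z u : Fin n) → E G x y → E G y z → E G z u →
       x ≢ z → y ≢ u → c x y ≢ c z u)

HasInjectiveEdgeColoring : ∀ {n} → Graph n → ℕ → Set
HasInjectiveEdgeColoring {n} G k =
  Σ (Fin n → Fin n → Fin k) λ c → InjectiveEdgeColoring G k c

IsInjectiveChromaticIndex : ∀ {n} → Graph n → ℕ → Set
IsInjectiveChromaticIndex G χ =
  HasInjectiveEdgeColoring G χ × (∀ k → k < χ → ¬ HasInjectiveEdgeColoring G k)

module Submission where

-- Let S be the smaller side of a bipartition of G and T = ∁ S the larger one,
-- with k = ∣S∣ ≤ q = ∣T∣ and k + q = n.  Colouring every edge by its endpoint
-- in S is an injective edge colouring with k colours: for consecutive edges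
-- xy, yz, zu exactly one of y, z lies in S, so the S-endpoints of xy and zu
-- are either x and z, or y and u, and these are distinct.  Hence χ ≤ k.
-- Since G is connected with n ≥ 2, no vertex is isolated, so T is an
-- independent dominating set, hence maximal independent: i(G) ≤ q ≤ α(G).
-- This gives χ ≤ k ≤ q ≤ α and χ ≤ k = n - q ≤ n - i.  For the first bound,
-- χΔ + (n - 1) ≤ nΔ: if Δ ≥ 2 it follows from n ≤ 2q ≤ qΔ; if Δ = 1 every
-- vertex has a unique neighbour, so connectivity forces n = 2 and χ ≤ 1.

open import Defs
open import Data.Nat using (ℕ; _+_; _*_; _∸_; _≤_)
open import Data.Product using (_×_)

open import Data.Nat using (zero; suc; _⊔_; z≤n; s≤s; _≤?_)
open import Data.Nat.Properties
open import Data.Product using (Σ; _,_; proj₁; proj₂)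
open import Data.Sum using (_⊎_; inj₁; inj₂)
open import Data.Bool using (Bool; true; false; T; if_then_else_)
open import Data.Bool.Properties using (¬-not)
open import Data.Fin using (Fin; fromℕ<) renaming (zero to fzero; suc to fsuc; _≟_ to _≟ᶠ_)
open import Data.Fin.Properties using () renaming (suc-injective to fsuc-injective)
open import Data.Fin.Subset using (Subset; _∈_; _∉_; ∣_∣; ∁)
open import Data.Fin.Subset.Properties
  using (_∈?_; x∈⁅x⁆; x∈p∪q⁺; x∈∁p⇒x∉p; x∉∁p⇒x∈p; x∉p⇒x∈∁p; ∣p∣≤n; ∣∁p∣≡n∸∣p∣)
open import Data.Vec using (_∷_; _[_]=_; here; there; tabulate)
open import Data.Vec.Properties using ([]=⇒lookup; lookup⇒[]=; lookup∘tabulate)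
import Data.List as List
open import Data.List using (foldr)
open import Data.List.Properties using (map-tabulate)
open import Data.Nat.ListAction using (sum)
open import Data.Empty using (⊥; ⊥-elim)
open import Relation.Nullary using (yes; no)
open import Relation.Binary.PropositionalEquality
  using (_≡_; _≢_; refl; cong; cong₂; subst; subst₂; trans) renaming (sym to ≡-sym)

sum-tabulate-≥ : ∀ {n} (g : Fin n → ℕ) a → g a ≤ sum (List.tabulate g)
sum-tabulate-≥ g fzero    = m≤m+n _ _
sum-tabulate-≥ g (fsuc a) = ≤-trans (sum-tabulate-≥ (λ x → g (fsuc x)) a) (m≤n+m _ _)

sum-tabulate-≥₂ : ∀ {n} (g : Fin n → ℕ) a b → a ≢ b →
                  g a + g b ≤ sum (List.tabulate g)
sum-tabulate-≥₂ g fzero fzero a≢b = ⊥-elim (a≢b refl)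
sum-tabulate-≥₂ g fzero (fsuc b) _ =
  +-monoʳ-≤ (g fzero) (sum-tabulate-≥ (λ x → g (fsuc x)) b)
sum-tabulate-≥₂ g (fsuc a) fzero _ =
  subst (_≤ sum (List.tabulate g)) (+-comm (g fzero) (g (fsuc a)))
    (+-monoʳ-≤ (g fzero) (sum-tabulate-≥ (λ x → g (fsuc x)) a))
sum-tabulate-≥₂ g (fsuc a) (fsuc b) a≢b =
  ≤-trans (sum-tabulate-≥₂ (λ x → g (fsuc x)) a b (λ a≡b → a≢b (cong fsuc a≡b)))
          (m≤n+m _ _)

max-tabulate-≥ : ∀ {n} (g : Fin n → ℕ) a → g a ≤ foldr _⊔_ 0 (List.tabulate g)
max-tabulate-≥ g fzero    = m≤m⊔n _ _
max-tabulate-≥ g (fsuc a) = ≤-trans (max-tabulate-≥ (λ x → g (fsuc x)) a) (m≤n⊔m _ _)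

module Degrees {n} (G : Graph n) where

  adjacent-sym : ∀ {u v} → E G u v → E G v u
  adjacent-sym {u} {v} = subst T (Graph.sym G u v)

  indicator : Fin n → Fin n → ℕ
  indicator u v = if adj G u v then 1 else 0

  indicator-edge : ∀ {u v} → E G u v → indicator u v ≡ 1
  indicator-edge {u} {v} uv with adj G u v
  ... | true = refl

  degree-as-sum : ∀ u → degree G u ≡ sum (List.tabulate (indicator u))
  degree-as-sum u = cong sum (map-tabulate (λ x → x) (indicator u))

  degree≤Δ : ∀ u → degree G u ≤ Δ G
  degree≤Δ u = subst (degree G u ≤_)
    (cong (foldr _⊔_ 0) (≡-sym (map-tabulate (λ x → x) (degree G))))
    (max-tabulate-≥ (degree G) u)

  edge⇒Δ≥1 : ∀ {u v} → E G u v → 1 ≤ Δ G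
  edge⇒Δ≥1 {u} {v} uv = ≤-trans
    (subst₂ _≤_ (indicator-edge uv) (≡-sym (degree-as-sum u))
      (sum-tabulate-≥ (indicator u) v))
    (degree≤Δ u)

  two-neighbours⇒Δ≥2 : ∀ {u a b} → E G u a → E G u b → a ≢ b → 2 ≤ Δ G
  two-neighbours⇒Δ≥2 {u} {a} {b} ua ub a≢b = ≤-trans
    (subst₂ _≤_ (cong₂ _+_ (indicator-edge ua) (indicator-edge ub))
      (≡-sym (degree-as-sum u)) (sum-tabulate-≥₂ (indicator u) a b a≢b))
    (degree≤Δ u)

  Δ≤1⇒unique-neighbour : Δ G ≤ 1 → ∀ {u a b} → E G u a → E G u b → a ≡ b
  Δ≤1⇒unique-neighbour Δ≤1 {u} {a} {b} ua ub with a ≟ᶠ b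
  ... | yes a≡b = a≡b
  ... | no a≢b  = ⊥-elim (1+n≰n (≤-trans (two-neighbours⇒Δ≥2 ua ub a≢b) Δ≤1))

walk-neighbour : ∀ {n} {G : Graph n} {u v} → u ≢ v → Walk G u v → Σ (Fin n) (E G u)
walk-neighbour u≢v here                = ⊥-elim (u≢v refl)
walk-neighbour _   (step {v = w} uw _) = w , uw

no-isolated-vertex : ∀ {n} (G : Graph n) → 2 ≤ n → Connected G →
                     ∀ u → Σ (Fin n) (E G u)
no-isolated-vertex G (s≤s (s≤s _)) conn fzero    =
  walk-neighbour (λ ()) (conn fzero (fsuc fzero))
no-isolated-vertex G (s≤s (s≤s _)) conn (fsuc u) =
  walk-neighbour (λ ()) (conn (fsuc u) fzero)

walk-stays-on-edge : ∀ {n} (G : Graph n) → (∀ {u a b} → E G u a → E G u b → a ≡ b) →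
                     ∀ {u w s v} → E G u w → Walk G s v → s ≡ u ⊎ s ≡ w → v ≡ u ⊎ v ≡ w
walk-stays-on-edge G unique uw here s∈uw = s∈uw
walk-stays-on-edge G unique uw (step sx walk) (inj₁ refl) =
  walk-stays-on-edge G unique uw walk (inj₂ (unique sx uw))
walk-stays-on-edge G unique uw (step sx walk) (inj₂ refl) =
  walk-stays-on-edge G unique uw walk (inj₁ (unique sx (Degrees.adjacent-sym G uw)))

-- A connected graph in which every vertex has at most one neighbour has at
-- most two vertices: vertices 1 and 2 would both be the neighbour of 0.
connected-matching⇒n≤2 : ∀ {n} (G : Graph n) → (∀ {u a b} → E G u a → E G u b → a ≡ b) →
                         Connected G → n ≤ 2
connected-matching⇒n≤2 {zero}             _ _ _ = z≤n
connected-matching⇒n≤2 {suc zero}         _ _ _ = s≤s z≤n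
connected-matching⇒n≤2 {suc (suc zero)}   _ _ _ = ≤-refl
connected-matching⇒n≤2 {suc (suc (suc n))} G unique conn =
  ⊥-elim (one-and-two-collapse (reach (conn fzero one)) (reach (conn fzero two)))
  where
  one two : Fin (3 + n)
  one = fsuc fzero
  two = fsuc (fsuc fzero)
  neighbour-of-0 : Σ (Fin (3 + n)) (E G fzero)
  neighbour-of-0 = walk-neighbour (λ ()) (conn fzero one)
  reach : ∀ {v} → Walk G fzero v → v ≡ fzero ⊎ v ≡ proj₁ neighbour-of-0
  reach walk = walk-stays-on-edge G unique (proj₂ neighbour-of-0) walk (inj₁ refl)
  one-and-two-collapse : one ≡ fzero ⊎ one ≡ proj₁ neighbour-of-0 →
                         two ≡ fzero ⊎ two ≡ proj₁ neighbour-of-0 → ⊥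
  one-and-two-collapse (inj₁ ())   _
  one-and-two-collapse (inj₂ _)    (inj₁ ())
  one-and-two-collapse (inj₂ 1≡w) (inj₂ 2≡w) with trans 1≡w (≡-sym 2≡w)
  ... | ()

-- Positions inside a subset: the members of p are numbered injectively by
-- Fin ∣ p ∣; this turns "colour an edge by a vertex of S" into ∣ S ∣ colours.

rank : ∀ {n} (p : Subset n) {v} → v ∈ p → Fin ∣ p ∣
rank (true  ∷ p) here        = fzero
rank (true  ∷ p) (there v∈p) = fsuc (rank p v∈p)
rank (false ∷ p) (there v∈p) = rank p v∈p

rank-injective : ∀ {n} (p : Subset n) {u v} (u∈p : u ∈ p) (v∈p : v ∈ p) →
                 rank p u∈p ≡ rank p v∈p → u ≡ v
rank-injective (true  ∷ p) here        here        _ = refl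
rank-injective (true  ∷ p) here        (there _)   ()
rank-injective (true  ∷ p) (there _)   here        ()
rank-injective (true  ∷ p) (there u∈p) (there v∈p) same =
  cong fsuc (rank-injective p u∈p v∈p (fsuc-injective same))
rank-injective (false ∷ p) (there u∈p) (there v∈p) same =
  cong fsuc (rank-injective p u∈p v∈p same)

∈-tabulate⁻ : ∀ {n} (g : Fin n → Bool) {v} → v ∈ tabulate g → g v ≡ true
∈-tabulate⁻ g {v} v∈ = trans (≡-sym (lookup∘tabulate g v)) ([]=⇒lookup v∈)

∈-tabulate⁺ : ∀ {n} (g : Fin n → Bool) {v} → g v ≡ true → v ∈ tabulate g
∈-tabulate⁺ g {v} gv = lookup⇒[]= v _ (trans (lookup∘tabulate g v) gv)

record Bipartition {n} (G : Graph n) (S : Subset n) : Set where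
  constructor bipartition
  field
    side-independent  : Independent G S
    other-independent : Independent G (∁ S)

open Bipartition

bipartition-from-colouring : ∀ {n} (G : Graph n) (f : Fin n → Bool) →
                             (∀ u v → E G u v → f u ≢ f v) → Bipartition G (tabulate f)
bipartition-from-colouring G f proper = bipartition
  (λ u v u∈ v∈ uv → proper u v uv (trans (∈-tabulate⁻ f u∈) (≡-sym (∈-tabulate⁻ f v∈))))
  (λ u v u∈ v∈ uv → proper u v uv (trans (false-side u∈) (≡-sym (false-side v∈))))
  where
  false-side : ∀ {v} → v ∈ ∁ (tabulate f) → f v ≡ false
  false-side v∈ = ¬-not (λ fv → x∈∁p⇒x∉p v∈ (∈-tabulate⁺ f fv))

opposite-∉ : ∀ {n} {G : Graph n} {S u v} → Bipartition G S → E G u v → u ∈ S → v ∉ S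
opposite-∉ {u = u} {v} bip uv u∈S v∈S = side-independent bip u v u∈S v∈S uv

opposite-∈ : ∀ {n} {G : Graph n} {S u v} → Bipartition G S → E G u v → u ∉ S → v ∈ S
opposite-∈ {u = u} {v} bip uv u∉S =
  x∉∁p⇒x∈p (λ v∈∁S → other-independent bip u v (x∉p⇒x∈∁p u∉S) v∈∁S uv)

bipartition-complement : ∀ {n} {G : Graph n} {S} → Bipartition G S → Bipartition G (∁ S)
bipartition-complement {S = S} bip =
  bipartition (other-independent bip)
              (λ u v u∈ v∈ → side-independent bip u v (double-∁ u∈) (double-∁ v∈))
  where
  double-∁ : ∀ {v} → v ∈ ∁ (∁ S) → v ∈ S
  double-∁ v∈ = x∉∁p⇒x∈p (x∈∁p⇒x∉p v∈)

side-sizes : ∀ {n} (S : Subset n) → ∣ S ∣ + ∣ ∁ S ∣ ≡ n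
side-sizes S = trans (cong (∣ S ∣ +_) (∣∁p∣≡n∸∣p∣ S)) (m+[n∸m]≡n (∣p∣≤n S))

smaller-side : ∀ {n} {G : Graph n} {P} → Bipartition G P →
               Σ (Subset n) λ S → Bipartition G S × ∣ S ∣ ≤ ∣ ∁ S ∣
smaller-side {n} {P = P} bip with ∣ P ∣ ≤? ∣ ∁ P ∣
... | yes P≤∁P = P , bip , P≤∁P
... | no  P≰∁P = ∁ P , bipartition-complement bip , ∁P≤∁∁P
  where
  open ≤-Reasoning
  ∁P≤∁∁P : ∣ ∁ P ∣ ≤ ∣ ∁ (∁ P) ∣
  ∁P≤∁∁P = begin
    ∣ ∁ P ∣            ≤⟨ <⇒≤ (≰⇒> P≰∁P) ⟩
    ∣ P ∣              ≡⟨ m∸[m∸n]≡n (∣p∣≤n P) ⟨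
    n ∸ (n ∸ ∣ P ∣)    ≡⟨ cong (n ∸_) (∣∁p∣≡n∸∣p∣ P) ⟨
    n ∸ ∣ ∁ P ∣        ≡⟨ ∣∁p∣≡n∸∣p∣ (∁ P) ⟨
    ∣ ∁ (∁ P) ∣        ∎

dominating⇒maximal : ∀ {n} (G : Graph n) {T} → Independent G T →
                     (∀ v → v ∉ T → Σ (Fin n) λ w → w ∈ T × E G v w) →
                     MaximalIndependent G T
dominating⇒maximal G independent dominating =
  independent , λ v v∉T independent′ →
    let (w , w∈T , vw) = dominating v v∉T
    in independent′ v w (x∈p∪q⁺ (inj₁ (x∈⁅x⁆ v))) (x∈p∪q⁺ (inj₂ w∈T)) vw

complement-side-maximal : ∀ {n} {G : Graph n} {S} → Bipartition G S →
                          (∀ u → Σ (Fin n) (E G u)) → MaximalIndependent G (∁ S)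
complement-side-maximal {G = G} bip neighbour =
  dominating⇒maximal G (other-independent bip) λ v v∉∁S →
    let (w , vw) = neighbour v
    in w , x∉p⇒x∈∁p (opposite-∉ bip vw (x∉∁p⇒x∈p v∉∁S)) , vw

edge-meets-side : ∀ {n} {G : Graph n} {S u v} → Bipartition G S → E G u v →
                  Σ (Fin n) (_∈ S)
edge-meets-side {S = S} {u} {v} bip uv with u ∈? S
... | yes u∈S = u , u∈S
... | no  u∉S = v , opposite-∈ bip uv u∉S

-- The member s∈S only supplies a
-- colour for non-adjacent pairs, whose colour is irrelevant.
module SideColouring {n} (G : Graph n) (S : Subset n) (bip : Bipartition G S)
                     {s} (s∈S : s ∈ S) where

  endpoint : Fin n → Fin n → Fin n
  endpoint x y with x ∈? S
  ... | yes _ = x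
  ... | no  _ = y

  endpoint-∈ : ∀ {x y} → x ∈ S → endpoint x y ≡ x
  endpoint-∈ {x} x∈S with x ∈? S
  ... | yes _   = refl
  ... | no  x∉S = ⊥-elim (x∉S x∈S)

  endpoint-∉ : ∀ {x y} → x ∉ S → endpoint x y ≡ y
  endpoint-∉ {x} x∉S with x ∈? S
  ... | yes x∈S = ⊥-elim (x∉S x∈S)
  ... | no  _   = refl

  endpoint-sym : ∀ {x y} → E G x y → endpoint x y ≡ endpoint y x
  endpoint-sym {x} xy with x ∈? S
  ... | yes x∈S = ≡-sym (endpoint-∉ (opposite-∉ bip xy x∈S))
  ... | no  x∉S = ≡-sym (endpoint-∈ (opposite-∈ bip xy x∉S))

  label : Fin n → Fin ∣ S ∣
  label v with v ∈? S
  ... | yes v∈S = rank S v∈S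
  ... | no  _   = rank S s∈S

  label-injective : ∀ {u v} → u ∈ S → v ∈ S → label u ≡ label v → u ≡ v
  label-injective {u} {v} u∈S v∈S same with u ∈? S | v ∈? S
  ... | yes u∈S′ | yes v∈S′ = rank-injective S u∈S′ v∈S′ same
  ... | no  u∉S  | _        = ⊥-elim (u∉S u∈S)
  ... | _        | no  v∉S  = ⊥-elim (v∉S v∈S)

  colour : Fin n → Fin n → Fin ∣ S ∣
  colour x y = label (endpoint x y)

  -- For consecutive edges xy, yz, zu: if y ∈ S the S-endpoints are y and u,
  -- otherwise they are x and z; equal colours would identify these.
  colour-injective : ∀ (x y z u : Fin n) → E G x y → E G y z → E G z u →
                     x ≢ z → y ≢ u → colour x y ≢ colour z u
  colour-injective x y z u xy yz zu x≢z y≢u same with y ∈? S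
  ... | yes y∈S = y≢u (label-injective y∈S u∈S
          (subst₂ (λ a b → label a ≡ label b) (endpoint-∉ x∉S) (endpoint-∉ z∉S) same))
    where
    x∉S : x ∉ S
    x∉S x∈S = opposite-∉ bip xy x∈S y∈S
    z∉S : z ∉ S
    z∉S = opposite-∉ bip yz y∈S
    u∈S : u ∈ S
    u∈S = opposite-∈ bip zu z∉S
  ... | no y∉S = x≢z (label-injective x∈S z∈S
          (subst₂ (λ a b → label a ≡ label b) (endpoint-∈ x∈S) (endpoint-∈ z∈S) same))
    where
    x∈S : x ∈ S
    x∈S = x∉∁p⇒x∈p (λ x∈∁S → other-independent bip x y x∈∁S (x∉p⇒x∈∁p y∉S) xy)
    z∈S : z ∈ S
    z∈S = opposite-∈ bip yz y∉S

  side-colouring : HasInjectiveEdgeColoring G ∣ S ∣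
  side-colouring = colour , (λ x y xy → cong label (endpoint-sym xy)) , colour-injective

-- Arithmetic.  Throughout, k ≤ q are the sizes of the two sides, n = k + q.

half-of-two : ∀ {k} → k + k ≤ 2 → k ≤ 1
half-of-two {zero}        _ = z≤n
half-of-two {suc zero}    _ = ≤-refl
half-of-two {suc (suc k)} (s≤s (s≤s k+2+k≤0)) with ≤-trans (m≤n+m (suc (suc k)) k) k+2+k≤0
... | ()

at-most-one-plus-pred : ∀ {k n} → k ≤ 1 → k ≤ n → k + (n ∸ 1) ≤ n
at-most-one-plus-pred {zero}  {n}     _ _       = m∸n≤m n 1
at-most-one-plus-pred {suc _} {suc n} (s≤s z≤n) _ = ≤-refl

-- The bound χΔ + (n - 1) ≤ nΔ for Δ = 1, which forces n ≤ 2 and so χ ≤ 1.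
bound-Δ≡1 : ∀ {χ k q} → χ ≤ k → k ≤ q → k + q ≤ 2 → χ * 1 + (k + q ∸ 1) ≤ (k + q) * 1
bound-Δ≡1 {χ} {k} {q} χ≤k k≤q k+q≤2 = begin
  χ * 1 + (k + q ∸ 1) ≡⟨ cong (_+ (k + q ∸ 1)) (*-identityʳ χ) ⟩
  χ + (k + q ∸ 1)     ≤⟨ +-monoˡ-≤ (k + q ∸ 1) χ≤k ⟩
  k + (k + q ∸ 1)     ≤⟨ at-most-one-plus-pred k≤1 (m≤m+n k q) ⟩
  k + q               ≡⟨ *-identityʳ (k + q) ⟨
  (k + q) * 1         ∎
  where
  open ≤-Reasoning
  k≤1 : k ≤ 1
  k≤1 = half-of-two (≤-trans (+-monoʳ-≤ k k≤q) k+q≤2)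

-- The bound χΔ + (n - 1) ≤ nΔ for Δ ≥ 2, via n ≤ 2q ≤ qΔ.
bound-Δ≥2 : ∀ {χ k q D} → χ ≤ k → k ≤ q → 2 ≤ D → χ * D + (k + q ∸ 1) ≤ (k + q) * D
bound-Δ≥2 {χ} {k} {q} {D} χ≤k k≤q 2≤D = begin
  χ * D + (k + q ∸ 1) ≤⟨ +-mono-≤ (*-monoˡ-≤ D χ≤k) (m∸n≤m (k + q) 1) ⟩
  k * D + (k + q)     ≤⟨ +-monoʳ-≤ (k * D) (+-monoˡ-≤ q k≤q) ⟩
  k * D + (q + q)     ≡⟨ cong (λ r → k * D + (q + r)) (+-identityʳ q) ⟨
  k * D + 2 * q       ≤⟨ +-monoʳ-≤ (k * D) (*-monoˡ-≤ q 2≤D) ⟩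
  k * D + D * q       ≡⟨ cong (k * D +_) (*-comm D q) ⟩
  k * D + q * D       ≡⟨ *-distribʳ-+ D k q ⟨
  (k + q) * D         ∎
  where open ≤-Reasoning

degree-bound : ∀ {χ k q n D} → k + q ≡ n → χ ≤ k → k ≤ q → 1 ≤ D → (D ≡ 1 → n ≤ 2) →
               χ * D + (n ∸ 1) ≤ n * D
degree-bound {D = suc zero}    refl χ≤k k≤q _ Δ≡1⇒n≤2 = bound-Δ≡1 χ≤k k≤q (Δ≡1⇒n≤2 refl)
degree-bound {D = suc (suc _)} refl χ≤k k≤q _ _       = bound-Δ≥2 χ≤k k≤q (s≤s (s≤s z≤n))

side-bound : ∀ {k q n m} → k + q ≡ n → m ≤ q → k ≤ n ∸ m
side-bound {k} {q} {m = m} refl m≤q =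
  subst (_≤ k + q ∸ m) (m+n∸n≡m k q) (∸-monoʳ-≤ (k + q) m≤q)

corollary1 : ∀ (n : ℕ) (G : Graph n) → 2 ≤ n → Connected G → Bipartite G →
    ∀ (χ a m : ℕ) → IsInjectiveChromaticIndex G χ →
    IsIndependenceNumber G a → IsIndependentDominationNumber G m →
    (χ * Δ G + (n ∸ 1) ≤ n * Δ G) × (χ ≤ n ∸ m) × (χ ≤ a)
corollary1 n G 2≤n conn (f , proper) χ a m
           (_ , fewer-colours-fail) (_ , α-maximum) (_ , i-minimum) =
  degree-bound (side-sizes S) χ≤k k≤q (Degrees.edge⇒Δ≥1 G v₀w) Δ≡1⇒n≤2
  , ≤-trans χ≤k (side-bound (side-sizes S) m≤q)
  , ≤-trans χ≤k (≤-trans k≤q q≤a)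
  where
  neighbour : ∀ u → Σ (Fin n) (E G u)
  neighbour = no-isolated-vertex G 2≤n conn
  v₀w : E G (fromℕ< 2≤n) (proj₁ (neighbour (fromℕ< 2≤n)))
  v₀w = proj₂ (neighbour (fromℕ< 2≤n))
  smaller : Σ (Subset n) λ S → Bipartition G S × ∣ S ∣ ≤ ∣ ∁ S ∣
  smaller = smaller-side (bipartition-from-colouring G f proper)
  S : Subset n
  S = proj₁ smaller
  bip : Bipartition G S
  bip = proj₁ (proj₂ smaller)
  k≤q : ∣ S ∣ ≤ ∣ ∁ S ∣
  k≤q = proj₂ (proj₂ smaller)
  χ≤k : χ ≤ ∣ S ∣
  χ≤k = ≮⇒≥ λ k<χ → fewer-colours-fail ∣ S ∣ k<χ
    (SideColouring.side-colouring G S bip (proj₂ (edge-meets-side bip v₀w)))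
  other-maximal : MaximalIndependent G (∁ S)
  other-maximal = complement-side-maximal bip neighbour
  m≤q : m ≤ ∣ ∁ S ∣
  m≤q = i-minimum (∁ S) other-maximal
  q≤a : ∣ ∁ S ∣ ≤ a
  q≤a = α-maximum (∁ S) (proj₁ other-maximal)
  Δ≡1⇒n≤2 : Δ G ≡ 1 → n ≤ 2
  Δ≡1⇒n≤2 Δ≡1 =
    connected-matching⇒n≤2 G (Degrees.Δ≤1⇒unique-neighbour G (≤-reflexive Δ≡1)) conn
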